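{- Let $x\in S_{2n}$ be a fixed-point-free involution, written uniquely as $x=(i_1,j_1)(i_2,j_2)\cdots(i_n,j_n)$ with $i_t<j_t$ for all $t$ and $i_1<i_2<\cdots<i_n$. Let $\widetilde{inv}(x)$ be the number of inversions of the word $i_1j_1i_2j_2\cdots i_nj_n$ (pairs of positions $p<q$ with the entry at $p$ larger than the entry at $q$), and let $c(x)$ be the number of crossing pairs of arcs in the arc diagram of $x$. Then $$\widetilde{inv}(x)=\sum_{t=1}^n (j_t-i_t-1)-c(x).$$
   Context: The arc diagram of a fixed-point-free involution $x$ of $\{1,\dots,2n\}$ places $1,\dots,2n$ on a horizontal line and joins $i$ and $x(i)$ by a concave-down arc for each $i$; $c(x)$ is the number of intersection points of these arcs, i.e. the number of pairs of transpositions $(a,b),(c,d)$ of $x$ with $a<c<b<d$. -}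

module Defs where

open import Data.Nat using (ℕ; zero; suc; _+_; _∸_; _<_; _<?_)
open import Data.Fin using (Fin; toℕ)
open import Data.List using (List; []; _∷_; length; filter; map; allFin; concatMap)
open import Data.Nat.ListAction using (sum)
open import Data.Product using (_×_; _,_; proj₁; proj₂)
open import Relation.Nullary using (¬_; Dec; yes; no)
open import Relation.Nullary.Decidable using (_×-dec_)
open import Relation.Binary.PropositionalEquality using (_≡_)

-- x is a fixed-point-free involution of the finite set Fin m
-- (points 0,…,m-1 stand for the paper's 1,…,m; all quantities below are
-- invariant under this shift).
record IsFPFInvolution {m : ℕ} (x : Fin m → Fin m) : Set where
  field
    involutive : ∀ i → x (x i) ≡ i
    fixedPointFree : ∀ i → ¬ (x i ≡ i)

-- The transpositions (i_t , j_t) of x with i_t < j_t, listed with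
-- i_1 < i_2 < … < i_n (allFin enumerates points in increasing order).
arcs : {m : ℕ} → (Fin m → Fin m) → List (ℕ × ℕ)
arcs {m} x =
  map (λ i → toℕ i , toℕ (x i))
      (filter (λ i → toℕ i <? toℕ (x i)) (allFin m))

arcWord : {m : ℕ} → (Fin m → Fin m) → List ℕ
arcWord x = concatMap (λ p → proj₁ p ∷ proj₂ p ∷ []) (arcs x)

inversions : List ℕ → ℕ
inversions [] = 0
inversions (a ∷ w) = length (filter (λ b → b <? a) w) + inversions w

crosses? : (p q : ℕ × ℕ) → Dec ((proj₁ p < proj₁ q) × (proj₁ q < proj₂ p) × (proj₂ p < proj₂ q))
crosses? (a , b) (c , d) = (a <? c) ×-dec ((c <? b) ×-dec (b <? d))

crossings : {m : ℕ} → (Fin m → Fin m) → ℕ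
crossings x = sum (map (λ p → length (filter (crosses? p) (arcs x))) (arcs x))

-- Σ_t (j_t − i_t − 1)   (each term is a genuine natural number since j_t > i_t)
arcLengthSum : {m : ℕ} → (Fin m → Fin m) → ℕ
arcLengthSum x = sum (map (λ p → proj₂ p ∸ proj₁ p ∸ 1) (arcs x))

-- Inversions occur only between two blocks (a , b), (c , d)
-- with a < c, and there are 0, 1 or 2 of them according as the arcs are
-- disjoint, crossing or nested.  Since every point is an endpoint of exactly
-- one arc, b − a − 1 counts the endpoints of other arcs strictly inside
-- (a , b); a pair of arcs contributes 0, 2 or 2 of these in the same three
-- cases, which is what the pair contributes to inversions plus crossings.
module Submission where

open import Defs
open import Data.Bool using (Bool; true; false)
open import Data.Empty using (⊥-elim)
open import Data.Fin using (Fin; toℕ; zero; suc)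
open import Data.Fin.Permutation using (permutation)
open import Data.Fin.Properties using (toℕ-injective; toℕ<n)
open import Data.Integer using (+_; _-_; _⊖_)
import Data.Integer.Properties as ℤ
open import Data.List using (List; []; _∷_; length; filter; map; allFin; tabulate; concatMap)
open import Data.List.Properties using (map-cong; map-cong-local; map-∘; map-tabulate; filter-reject)
open import Data.List.Relation.Unary.All using (All; []; _∷_)
import Data.List.Relation.Unary.All as All
import Data.List.Relation.Unary.All.Properties as All
open import Data.List.Relation.Unary.AllPairs using (AllPairs; []; _∷_)
import Data.List.Relation.Unary.AllPairs.Properties as AllPairs
open import Data.Nat using (ℕ; zero; suc; _+_; _*_; _∸_; _<_; _≤_; _<ᵇ_; _<?_; z≤n; s≤s)
open import Data.Nat.ListAction using (sum)
open import Data.Nat.Properties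
  using ( +-assoc; +-identityʳ; *-zeroʳ; *-distribˡ-+; *-distribʳ-+; +-0-commutativeMonoid
        ; +-commutativeSemigroup
        ; <⇒≤; <⇒≯; <-trans; <-irrefl; <-asym; <-cmp; ≤-refl; 0∸n≡0; m≤n+m; m+n∸n≡m)
open import Data.Product using (_×_; _,_; proj₁; proj₂)
open import Relation.Binary using (tri<; tri≈; tri>)
open import Relation.Binary.PropositionalEquality
  using (_≡_; _≢_; refl; sym; trans; cong; cong₂; subst; module ≡-Reasoning)
open import Relation.Nullary using (Dec; does)
open import Relation.Unary using (Decidable)
open import Algebra.Properties.CommutativeMonoid.Sum +-0-commutativeMonoid
  using (sum-syntax; ∑-distrib-+; sum-cong-≗; sum-permute; sum-replicate-zero)
  renaming (sum to ∑)
open import Algebra.Properties.CommutativeSemigroup +-commutativeSemigroup using (interchange)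

private variable
  A : Set

𝕀 : Bool → ℕ
𝕀 true = 1
𝕀 false = 0

⟦_<_⟧ : ℕ → ℕ → ℕ
⟦ m < n ⟧ = 𝕀 (m <ᵇ n)

<⇒<ᵇ≡true : ∀ {m n} → m < n → (m <ᵇ n) ≡ true
<⇒<ᵇ≡true {zero} {suc n} _ = refl
<⇒<ᵇ≡true {suc m} {suc n} (s≤s m<n) = <⇒<ᵇ≡true m<n

≥⇒<ᵇ≡false : ∀ {m n} → n ≤ m → (m <ᵇ n) ≡ false
≥⇒<ᵇ≡false {m} {zero} _ = refl
≥⇒<ᵇ≡false {suc m} {suc n} (s≤s n≤m) = ≥⇒<ᵇ≡false n≤m

⟦<⟧+⟦>⟧≡1 : ∀ {m n} → m ≢ n → ⟦ m < n ⟧ + ⟦ n < m ⟧ ≡ 1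
⟦<⟧+⟦>⟧≡1 {m} {n} m≢n with <-cmp m n
... | tri< m<n _ _ rewrite <⇒<ᵇ≡true m<n | ≥⇒<ᵇ≡false (<⇒≤ m<n) = refl
... | tri≈ _ m≡n _ = ⊥-elim (m≢n m≡n)
... | tri> _ _ n<m rewrite ≥⇒<ᵇ≡false (<⇒≤ n<m) | <⇒<ᵇ≡true n<m = refl

length-filter≡sum : {P : A → Set} (P? : Decidable P) (xs : List A) →
  length (filter P? xs) ≡ sum (map (λ y → 𝕀 (does (P? y))) xs)
length-filter≡sum P? [] = refl
length-filter≡sum P? (y ∷ xs) with does (P? y)
... | true = cong suc (length-filter≡sum P? xs)
... | false = length-filter≡sum P? xs

sum-map-filter : {P : A → Set} (P? : Decidable P) (f : A → ℕ) (xs : List A) →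
  sum (map f (filter P? xs)) ≡ sum (map (λ y → 𝕀 (does (P? y)) * f y) xs)
sum-map-filter P? f [] = refl
sum-map-filter P? f (y ∷ xs) with does (P? y)
... | true = cong₂ _+_ (sym (+-identityʳ (f y))) (sum-map-filter P? f xs)
... | false = sum-map-filter P? f xs

sum-map-+ : (f g : A → ℕ) (xs : List A) →
  sum (map (λ y → f y + g y) xs) ≡ sum (map f xs) + sum (map g xs)
sum-map-+ f g [] = refl
sum-map-+ f g (y ∷ xs) =
  trans (cong (λ s → f y + g y + s) (sum-map-+ f g xs)) (interchange (f y) (g y) _ _)

sum-map-allFin : ∀ {m} (f : Fin m → ℕ) → sum (map f (allFin m)) ≡ ∑[ i < m ] f i
sum-map-allFin {m} f = trans (cong sum (map-tabulate (λ i → i) f)) (sum-tabulate f)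
  where
  sum-tabulate : ∀ {n} (g : Fin n → ℕ) → sum (tabulate g) ≡ ∑[ i < n ] g i
  sum-tabulate {zero} g = refl
  sum-tabulate {suc n} g = cong (λ s → g zero + s) (sum-tabulate (λ i → g (suc i)))

pairSum : (A → A → ℕ) → List A → ℕ
pairSum h [] = 0
pairSum h (p ∷ ps) = sum (map (h p) ps) + pairSum h ps

doubleSum : (A → A → ℕ) → List A → ℕ
doubleSum h ps = sum (map (λ p → sum (map (h p) ps)) ps)

pairSum-+ : (h k : A → A → ℕ) (ps : List A) →
  pairSum (λ p q → h p q + k p q) ps ≡ pairSum h ps + pairSum k ps
pairSum-+ h k [] = refl
pairSum-+ h k (p ∷ ps) =
  trans (cong₂ _+_ (sum-map-+ (h p) (k p) ps) (pairSum-+ h k ps))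
        (interchange (sum (map (h p) ps)) _ _ _)

pairSum-cong : {h k : A → A → ℕ} {ps : List A} →
  AllPairs (λ p q → h p q ≡ k p q) ps → pairSum h ps ≡ pairSum k ps
pairSum-cong [] = refl
pairSum-cong (h≡k ∷ hs≡ks) = cong₂ _+_ (cong sum (map-cong-local h≡k)) (pairSum-cong hs≡ks)

doubleSum≡pairSum : {A : Set} (h : A → A → ℕ) → (∀ p → h p p ≡ 0) → (ps : List A) →
  doubleSum h ps ≡ pairSum (λ p q → h p q + h q p) ps
doubleSum≡pairSum h h-irrefl [] = refl
doubleSum≡pairSum {A} h h-irrefl (p ∷ ps) = begin
  (h p p + Σh p) + sum (map (λ q → h q p + Σh q) ps)
    ≡⟨ cong₂ _+_ (cong (λ s → s + Σh p) (h-irrefl p)) (sum-map-+ (λ q → h q p) Σh ps) ⟩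
  Σh p + (sum (map (λ q → h q p) ps) + doubleSum h ps)
    ≡⟨ sym (+-assoc (Σh p) _ _) ⟩
  Σh p + sum (map (λ q → h q p) ps) + doubleSum h ps
    ≡⟨ cong₂ _+_ (sym (sum-map-+ (h p) (λ q → h q p) ps)) (doubleSum≡pairSum h h-irrefl ps) ⟩
  sum (map (λ q → h p q + h q p) ps) + pairSum (λ p q → h p q + h q p) ps
    ∎
  where
  open ≡-Reasoning
  Σh : A → ℕ
  Σh q = sum (map (h q) ps)

AllPairs-mapWithAll : {P : A → Set} {R S : A → A → Set} →
  (∀ {p q} → P q → R p q → S p q) →
  {ps : List A} → All P ps → AllPairs R ps → AllPairs S ps
AllPairs-mapWithAll f [] [] = []
AllPairs-mapWithAll f (_ ∷ Pps) (Rps ∷ Rpss) =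
  All.zipWith (λ (Pq , Rpq) → f Pq Rpq) (Pps , Rps) ∷ AllPairs-mapWithAll f Pps Rpss

Arc : Set
Arc = ℕ × ℕ

IsArc : Arc → Set
IsArc (a , b) = a < b

Precedes : Arc → Arc → Set
Precedes (a , b) (c , d) = a < c × b ≢ c × b ≢ d

word : List Arc → List ℕ
word = concatMap (λ p → proj₁ p ∷ proj₂ p ∷ [])

endpointSum : (ℕ → ℕ) → Arc → ℕ
endpointSum u (a , b) = u a + u b

sum-map-word : (u : ℕ → ℕ) (ps : List Arc) →
  sum (map u (word ps)) ≡ sum (map (endpointSum u) ps)
sum-map-word u [] = refl
sum-map-word u ((a , b) ∷ ps) =
  trans (cong (λ s → u a + (u b + s)) (sum-map-word u ps)) (sym (+-assoc (u a) (u b) _))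

inversionsBetween : Arc → Arc → ℕ
inversionsBetween p q = endpointSum (λ u → endpointSum (λ v → ⟦ v < u ⟧) q) p

inside : Arc → ℕ → ℕ
inside (a , b) k = ⟦ a < k ⟧ * ⟦ k < b ⟧

nested : Arc → Arc → ℕ
nested p q = endpointSum (inside p) q

crossing : Arc → Arc → ℕ
crossing p q = 𝕀 (does (crosses? p q))

inversions-word : {ps : List Arc} → All IsArc ps →
  inversions (word ps) ≡ pairSum inversionsBetween ps
inversions-word [] = refl
inversions-word {(a , b) ∷ ps} (a<b ∷ arcs) = begin
  length (filter (_<? a) (b ∷ word ps)) + (length (filter (_<? b) (word ps)) + inversions (word ps))
    ≡⟨ cong (λ w → length w + _) (filter-reject (_<? a) (<⇒≯ a<b)) ⟩
  length (filter (_<? a) (word ps)) + (length (filter (_<? b) (word ps)) + inversions (word ps))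
    ≡⟨ cong₂ _+_ (below a) (cong₂ _+_ (below b) (inversions-word arcs)) ⟩
  sum (map (endpointSum ⟦_< a ⟧) ps) + (sum (map (endpointSum ⟦_< b ⟧) ps) + pairSum inversionsBetween ps)
    ≡⟨ sym (+-assoc (sum (map (endpointSum ⟦_< a ⟧) ps)) _ _) ⟩
  sum (map (endpointSum ⟦_< a ⟧) ps) + sum (map (endpointSum ⟦_< b ⟧) ps) + pairSum inversionsBetween ps
    ≡⟨ cong (λ s → s + pairSum inversionsBetween ps) (sym (sum-map-+ (endpointSum ⟦_< a ⟧) _ ps)) ⟩
  sum (map (inversionsBetween (a , b)) ps) + pairSum inversionsBetween ps
    ∎
  where
  open ≡-Reasoning
  below : ∀ u → length (filter (_<? u) (word ps)) ≡ sum (map (endpointSum ⟦_< u ⟧) ps)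
  below u = trans (length-filter≡sum (_<? u) (word ps)) (sum-map-word ⟦_< u ⟧ ps)

-- b < c, c < b < d and d < b are the disjoint, crossing and nested cases.
inversions+crossings≡nested : ∀ {p q} → IsArc q → Precedes p q →
  inversionsBetween p q + (crossing p q + crossing q p) ≡ nested p q + nested q p
inversions+crossings≡nested {a , b} {c , d} c<d (a<c , b≢c , b≢d)
  rewrite ≥⇒<ᵇ≡false (<⇒≤ a<c) | ≥⇒<ᵇ≡false (<⇒≤ (<-trans a<c c<d))
        | <⇒<ᵇ≡true a<c | <⇒<ᵇ≡true (<-trans a<c c<d)
  with <-cmp b c | <-cmp b d
... | tri< b<c _ _ | _
  rewrite ≥⇒<ᵇ≡false (<⇒≤ b<c) | ≥⇒<ᵇ≡false (<⇒≤ (<-trans b<c c<d)) = refl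
... | tri≈ _ b≡c _ | _ = ⊥-elim (b≢c b≡c)
... | tri> _ _ c<b | tri< b<d _ _
  rewrite <⇒<ᵇ≡true c<b | ≥⇒<ᵇ≡false (<⇒≤ b<d) | <⇒<ᵇ≡true b<d = refl
... | tri> _ _ _ | tri≈ _ b≡d _ = ⊥-elim (b≢d b≡d)
... | tri> _ _ c<b | tri> _ _ d<b
  rewrite <⇒<ᵇ≡true c<b | <⇒<ᵇ≡true d<b | ≥⇒<ᵇ≡false (<⇒≤ d<b) = refl

crossing-irrefl : ∀ p → crossing p p ≡ 0
crossing-irrefl (a , b) rewrite ≥⇒<ᵇ≡false (≤-refl {a}) = refl

nested-irrefl : ∀ p → nested p p ≡ 0
nested-irrefl (a , b) rewrite ≥⇒<ᵇ≡false (≤-refl {a}) | ≥⇒<ᵇ≡false (≤-refl {b}) =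
  *-zeroʳ ⟦ a < b ⟧

inversions+doubleSum-crossing : {ps : List Arc} → All IsArc ps → AllPairs Precedes ps →
  inversions (word ps) + doubleSum crossing ps ≡ doubleSum nested ps
inversions+doubleSum-crossing {ps} arcs precedes = begin
  inversions (word ps) + doubleSum crossing ps
    ≡⟨ cong₂ _+_ (inversions-word arcs) (doubleSum≡pairSum crossing crossing-irrefl ps) ⟩
  pairSum inversionsBetween ps + pairSum (λ p q → crossing p q + crossing q p) ps
    ≡⟨ sym (pairSum-+ inversionsBetween _ ps) ⟩
  pairSum (λ p q → inversionsBetween p q + (crossing p q + crossing q p)) ps
    ≡⟨ pairSum-cong (AllPairs-mapWithAll inversions+crossings≡nested arcs precedes) ⟩
  pairSum (λ p q → nested p q + nested q p) ps
    ≡⟨ sym (doubleSum≡pairSum nested nested-irrefl ps) ⟩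
  doubleSum nested ps
    ∎
  where open ≡-Reasoning

∑-⟦<⟧ : ∀ {m} b → b ≤ m → ∑[ k < m ] ⟦ toℕ k < b ⟧ ≡ b
∑-⟦<⟧ {zero} zero z≤n = refl
∑-⟦<⟧ {suc m} zero _ = sum-replicate-zero (suc m)
∑-⟦<⟧ {suc m} (suc b) (s≤s b≤m) = cong suc (∑-⟦<⟧ b b≤m)

∑-inside : ∀ {m} a b → b ≤ m → ∑[ k < m ] inside (a , b) (toℕ k) ≡ b ∸ a ∸ 1
∑-inside {m} a zero _ = begin
  ∑[ k < m ] (⟦ a < toℕ k ⟧ * 0) ≡⟨ sum-cong-≗ {m} (λ k → *-zeroʳ ⟦ a < toℕ k ⟧) ⟩
  ∑[ k < m ] 0                   ≡⟨ sum-replicate-zero m ⟩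
  0                              ≡⟨ sym (cong (λ s → s ∸ 1) (0∸n≡0 a)) ⟩
  0 ∸ a ∸ 1                      ∎
  where open ≡-Reasoning
∑-inside {suc m} zero (suc b) (s≤s b≤m) =
  trans (sum-cong-≗ {m} (λ k → +-identityʳ ⟦ toℕ k < b ⟧)) (∑-⟦<⟧ b b≤m)
∑-inside {suc m} (suc a) (suc b) (s≤s b≤m) = ∑-inside a b b≤m

∑-involution : ∀ {m} (x : Fin m → Fin m) → (∀ i → x (x i) ≡ i) →
  (f : Fin m → ℕ) → ∑[ i < m ] f i ≡ ∑[ i < m ] f (x i)
∑-involution x involutive f = sum-permute f (permutation x x involutive involutive)

module ArcsOfInvolution {m} (x : Fin m → Fin m) (fpf : IsFPFInvolution x) where
  open IsFPFInvolution fpf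

  arc : Fin m → Arc
  arc i = toℕ i , toℕ (x i)

  opens? : (i : Fin m) → Dec (toℕ i < toℕ (x i))
  opens? i = toℕ i <? toℕ (x i)

  sum-map-arcs : (f : Arc → ℕ) →
    sum (map f (arcs x)) ≡ ∑[ i < m ] (⟦ toℕ i < toℕ (x i) ⟧ * f (arc i))
  sum-map-arcs f = begin
    sum (map f (map arc (filter opens? (allFin m))))
      ≡⟨ cong sum (sym (map-∘ (filter opens? (allFin m)))) ⟩
    sum (map (λ i → f (arc i)) (filter opens? (allFin m)))
      ≡⟨ sum-map-filter opens? (λ i → f (arc i)) (allFin m) ⟩
    sum (map (λ i → ⟦ toℕ i < toℕ (x i) ⟧ * f (arc i)) (allFin m))
      ≡⟨ sum-map-allFin (λ i → ⟦ toℕ i < toℕ (x i) ⟧ * f (arc i)) ⟩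
    ∑[ i < m ] (⟦ toℕ i < toℕ (x i) ⟧ * f (arc i))
      ∎
    where open ≡-Reasoning

  -- Each point is the left endpoint of its arc or the right one, never both.
  sum-endpointSum-arcs : (u : ℕ → ℕ) → sum (map (endpointSum u) (arcs x)) ≡ ∑[ i < m ] u (toℕ i)
  sum-endpointSum-arcs u = begin
    sum (map (endpointSum u) (arcs x))
      ≡⟨ sum-map-arcs (endpointSum u) ⟩
    ∑[ i < m ] (opens i * (u (toℕ i) + u (toℕ (x i))))
      ≡⟨ sum-cong-≗ {m} (λ i → *-distribˡ-+ (opens i) (u (toℕ i)) _) ⟩
    ∑[ i < m ] (opens i * u (toℕ i) + opens i * u (toℕ (x i)))
      ≡⟨ ∑-distrib-+ (λ i → opens i * u (toℕ i)) _ ⟩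
    ∑[ i < m ] (opens i * u (toℕ i)) + ∑[ i < m ] (opens i * u (toℕ (x i)))
      ≡⟨ cong (λ s → ∑[ i < m ] (opens i * u (toℕ i)) + s) closes-reindexed ⟩
    ∑[ i < m ] (opens i * u (toℕ i)) + ∑[ i < m ] (closes i * u (toℕ i))
      ≡⟨ sym (∑-distrib-+ (λ i → opens i * u (toℕ i)) _) ⟩
    ∑[ i < m ] (opens i * u (toℕ i) + closes i * u (toℕ i))
      ≡⟨ sum-cong-≗ {m} (λ i → trans (sym (*-distribʳ-+ (u (toℕ i)) (opens i) (closes i)))
                                 (trans (cong (λ s → s * u (toℕ i)) (opens+closes≡1 i))
                                        (+-identityʳ (u (toℕ i))))) ⟩
    ∑[ i < m ] u (toℕ i)
      ∎
    where
    open ≡-Reasoning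
    opens closes : Fin m → ℕ
    opens i = ⟦ toℕ i < toℕ (x i) ⟧
    closes i = ⟦ toℕ (x i) < toℕ i ⟧
    opens+closes≡1 : ∀ i → opens i + closes i ≡ 1
    opens+closes≡1 i = ⟦<⟧+⟦>⟧≡1 (λ i≡xi → fixedPointFree i (sym (toℕ-injective i≡xi)))
    closes-reindexed : ∑[ i < m ] (opens i * u (toℕ (x i))) ≡ ∑[ i < m ] (closes i * u (toℕ i))
    closes-reindexed = trans
      (sum-cong-≗ {m} (λ i → cong (λ j → ⟦ toℕ j < toℕ (x i) ⟧ * u (toℕ (x i))) (sym (involutive i))))
      (sym (∑-involution x involutive (λ i → closes i * u (toℕ i))))

  arcs-IsArc : All IsArc (arcs x)
  arcs-IsArc = All.map⁺ (All.all-filter opens? (allFin m))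

  arcs-bounded : All (λ p → proj₂ p ≤ m) (arcs x)
  arcs-bounded = All.map⁺ (All.filter⁺ opens? (All.tabulate⁺ (λ i → <⇒≤ (toℕ<n (x i)))))

  arcs-Precedes : AllPairs Precedes (arcs x)
  arcs-Precedes = AllPairs.map⁺ (AllPairs-mapWithAll precedes
    (All.all-filter opens? (allFin m))
    (AllPairs.filter⁺ opens? (AllPairs.tabulate⁺-< (λ i<j → i<j))))
    where
    precedes : ∀ {i j} → toℕ j < toℕ (x j) → toℕ i < toℕ j → Precedes (arc i) (arc j)
    precedes {i} {j} j<xj i<j = i<j , xi≢j , xi≢xj
      where
      xi≢j : toℕ (x i) ≢ toℕ j
      xi≢j xi≡j = <-asym i<j (subst (λ k → toℕ j < toℕ k) xj≡i j<xj)
        where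
        xj≡i : x j ≡ i
        xj≡i = trans (cong x (sym (toℕ-injective xi≡j))) (involutive i)
      xi≢xj : toℕ (x i) ≢ toℕ (x j)
      xi≢xj xi≡xj = <-irrefl (cong toℕ i≡j) i<j
        where
        i≡j : i ≡ j
        i≡j = trans (sym (involutive i)) (trans (cong x (toℕ-injective xi≡xj)) (involutive j))

  arcLengthSum≡doubleSum-nested : arcLengthSum x ≡ doubleSum nested (arcs x)
  arcLengthSum≡doubleSum-nested = cong sum (map-cong-local (All.map
    (λ {p} b≤m → sym (trans (sum-endpointSum-arcs (inside p)) (∑-inside (proj₁ p) (proj₂ p) b≤m)))
    arcs-bounded))

  crossings≡doubleSum : crossings x ≡ doubleSum crossing (arcs x)
  crossings≡doubleSum = cong sum (map-cong (λ p → length-filter≡sum (crosses? p) (arcs x)) (arcs x))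

  inversions+crossings≡arcLengthSum : inversions (arcWord x) + crossings x ≡ arcLengthSum x
  inversions+crossings≡arcLengthSum = begin
    inversions (word (arcs x)) + crossings x
      ≡⟨ cong (λ s → inversions (word (arcs x)) + s) crossings≡doubleSum ⟩
    inversions (word (arcs x)) + doubleSum crossing (arcs x)
      ≡⟨ inversions+doubleSum-crossing arcs-IsArc arcs-Precedes ⟩
    doubleSum nested (arcs x)
      ≡⟨ sym arcLengthSum≡doubleSum-nested ⟩
    arcLengthSum x
      ∎
    where open ≡-Reasoning

+[m+n]-+n≡+m : ∀ m n → + (m + n) - + n ≡ + m
+[m+n]-+n≡+m m n = begin
  + (m + n) - + n  ≡⟨ ℤ.m-n≡m⊖n (m + n) n ⟩
  (m + n) ⊖ n      ≡⟨ ℤ.≤-⊖ (m≤n+m n m) ⟩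
  + (m + n ∸ n)    ≡⟨ cong +_ (m+n∸n≡m m n) ⟩
  + m              ∎
  where open ≡-Reasoning

mainTheorem2 : (n : ℕ) (x : Fin (2 * n) → Fin (2 * n)) → IsFPFInvolution x →
    + inversions (arcWord x) ≡ + arcLengthSum x - + crossings x
mainTheorem2 n x fpf = begin
  + inversions (arcWord x)                                ≡⟨ sym (+[m+n]-+n≡+m _ (crossings x)) ⟩
  + (inversions (arcWord x) + crossings x) - + crossings x
    ≡⟨ cong (λ s → + s - + crossings x) (ArcsOfInvolution.inversions+crossings≡arcLengthSum x fpf) ⟩
  + arcLengthSum x - + crossings x                        ∎
  where open ≡-Reasoning
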